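{- If a graph $G$ has a dominating induced matching then for every vertex $v$, the subgraph $G[N(v)]$ induced by the neighborhood of $v$ is the disjoint union of at most one star containing an induced $P_3$, together with isolated edges and isolated vertices.
   Context: A dominating induced matching of $G=(V,E)$ is a set $M\subseteq E$ such that distinct edges of $M$ are disjoint and joined by no edge of $G$, and every edge of $E\setminus M$ shares an endpoint with an edge of $M$. A star is $K_{1,k}$; $N(v)$ is the open neighborhood of $v$; $P_3$ is the chordless path on 3 vertices. -}

module Defs where

open import Data.Nat using (ℕ)
open import Data.Fin using (Fin)
open import Data.Product using (Σ; ∃; _×_; _,_)
open import Data.Sum using (_⊎_)
open import Relation.Nullary using (¬_; Dec)
open import Relation.Binary.PropositionalEquality using (_≡_; _≢_)

record Graph (n : ℕ) : Set₁ where
  field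
    Adj   : Fin n → Fin n → Set
    sym   : ∀ {x y} → Adj x y → Adj y x
    irrefl : ∀ {x} → ¬ Adj x x
    Adj?  : ∀ x y → Dec (Adj x y)
open Graph public

SameEdge : ∀ {n} → Fin n → Fin n → Fin n → Fin n → Set
SameEdge a b c d = (a ≡ c × b ≡ d) ⊎ (a ≡ d × b ≡ c)

record EdgeSet {n : ℕ} (G : Graph n) : Set₁ where
  field
    InM    : Fin n → Fin n → Set
    M-sym  : ∀ {x y} → InM x y → InM y x
    M⊆E    : ∀ {x y} → InM x y → Adj G x y
    InM?   : ∀ x y → Dec (InM x y)
open EdgeSet public

record IsDIM {n : ℕ} (G : Graph n) (M : EdgeSet G) : Set where
  field
    disjoint : ∀ a b c d → InM M a b → InM M c d → a ≡ c → SameEdge a b c d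
    induced  : ∀ a b c d → InM M a b → InM M c d → Adj G a c → SameEdge a b c d
    dominating : ∀ x y → Adj G x y → ¬ InM M x y →
                 ∃ λ w → InM M x w ⊎ InM M y w

HasDIM : ∀ {n} → Graph n → Set₁
HasDIM G = Σ (EdgeSet G) λ M → IsDIM G M

InducesK1 : ∀ {n} → Graph n → (Fin n → Set) → Set
InducesK1 G S = ∃ λ a → S a × (∀ x → S x → x ≡ a)

InducesK2 : ∀ {n} → Graph n → (Fin n → Set) → Set
InducesK2 G S = Σ _ λ a → Σ _ λ b →
  S a × S b × Adj G a b × (∀ x → S x → x ≡ a ⊎ x ≡ b)

InducesBigStar : ∀ {n} → Graph n → (Fin n → Set) → Set
InducesBigStar G S = Σ _ λ c → Σ _ λ a → Σ _ λ b →
  S c × S a × S b × a ≢ b × a ≢ c × b ≢ c ×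
  (∀ x → S x → x ≢ c → Adj G c x) ×
  (∀ x y → S x → S y → x ≢ c → y ≢ c → ¬ Adj G x y)

-- G[N(v)] is a disjoint union of at most one star containing an induced P₃,
-- together with isolated edges and isolated vertices: N(v) is split into
-- parts (labelled by comp), with no edges between distinct parts, each
-- nonempty part inducing K₁, K₂ or a star with ≥ 2 leaves, and at most one
-- part of the latter kind.
module _ {n : ℕ} (G : Graph n) (v : Fin n) where
  Part : (Fin n → Fin n) → Fin n → Fin n → Set
  Part comp p x = Adj G v x × comp x ≡ p

  NbhdStarShape : Set
  NbhdStarShape = Σ (Fin n → Fin n) λ comp →
    (∀ x y → Adj G v x → Adj G v y → Adj G x y → comp x ≡ comp y) ×
    (∀ p → (∃ λ x → Part comp p x) →
       InducesK1 G (Part comp p) ⊎ InducesK2 G (Part comp p)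
         ⊎ InducesBigStar G (Part comp p)) ×
    (∀ p q → InducesBigStar G (Part comp p) → InducesBigStar G (Part comp q) → p ≡ q)

module Submission where

-- * If v is matched, say vu ∈ M, then no M-edge touches a neighbour
--   x ≠ u of v (M is induced), so N(v) ∖ {u} is independent (M is
--   dominating).  Hence G[N(v)] is the star centred at u with leaves
--   N(u) ∩ N(v), plus isolated vertices.
-- * If v is unmatched, every neighbour of v is matched (domination of the
--   edge vx) and every edge inside N(v) lies in M (M is induced).  Hence
--   G[N(v)] is a matching plus isolated vertices.
--
-- In both cases N(v) is partitioned into parts, each a star around a
-- chosen centre, with no edges between parts.

open import Defs
open import Data.Nat using (ℕ)
open import Data.Fin using (Fin; _<_)
open import Data.Fin.Properties using (_≟_; _<?_; <-cmp; any?; <-asym)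
open import Data.Product using (∃; _×_; _,_; proj₁)
open import Data.Sum using (_⊎_; inj₁; inj₂)
open import Data.Empty using (⊥-elim)
open import Relation.Nullary using (¬_; Dec; yes; no; ¬?)
open import Relation.Nullary.Decidable using (_×-dec_)
open import Relation.Binary.PropositionalEquality
  using (_≡_; _≢_; refl; trans; subst) renaming (sym to ≡-sym)
open import Relation.Binary.Definitions using (tri<; tri≈; tri>)

IsStarAt : ∀ {n} → Graph n → (Fin n → Set) → Fin n → Set
IsStarAt G S c =
  S c × (∀ x → S x → x ≢ c → Adj G c x) ×
  (∀ x y → S x → S y → x ≢ c → y ≢ c → ¬ Adj G x y)

starShape : ∀ {n} (G : Graph n) (S : Fin n → Set) → (∀ x → Dec (S x)) →
            ∀ c → IsStarAt G S c →
            InducesK1 G S ⊎ InducesK2 G S ⊎ InducesBigStar G S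
starShape G S S? c (sc , centre , leavesIndep)
  with any? (λ a → S? a ×-dec ¬? (a ≟ c))
... | no noLeaf = inj₁ (c , sc , onlyCentre)
  where
  onlyCentre : ∀ x → S x → x ≡ c
  onlyCentre x sx with x ≟ c
  ... | yes x≡c = x≡c
  ... | no x≢c = ⊥-elim (noLeaf (x , sx , x≢c))
... | yes (a , sa , a≢c) with any? (λ b → (S? b ×-dec ¬? (b ≟ c)) ×-dec ¬? (b ≟ a))
...   | no noOtherLeaf = inj₂ (inj₁ (c , a , sc , sa , centre a sa a≢c , centreOrLeaf))
  where
  centreOrLeaf : ∀ x → S x → x ≡ c ⊎ x ≡ a
  centreOrLeaf x sx with x ≟ c | x ≟ a
  ... | yes x≡c | _ = inj₁ x≡c
  ... | no _ | yes x≡a = inj₂ x≡a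
  ... | no x≢c | no x≢a = ⊥-elim (noOtherLeaf (x , (sx , x≢c) , x≢a))
...   | yes (b , (sb , b≢c) , b≢a) =
  inj₂ (inj₂ (c , a , b , sc , sa , sb , (λ a≡b → b≢a (≡-sym a≡b)) , a≢c , b≢c ,
              centre , leavesIndep))

singletonStar : ∀ {n} (G : Graph n) (S : Fin n → Set) c →
                S c → (∀ x → S x → x ≡ c) → IsStarAt G S c
singletonStar G S c sc only =
  sc , (λ x sx x≢c → ⊥-elim (x≢c (only x sx))) ,
       (λ x _ sx _ x≢c _ → ⊥-elim (x≢c (only x sx)))

subsingleton⇒¬bigStar : ∀ {n} (G : Graph n) (S : Fin n → Set) →
                        (∀ x y → S x → S y → x ≡ y) → ¬ InducesBigStar G S
subsingleton⇒¬bigStar G S sub (_ , a , b , _ , sa , sb , a≢b , _) = a≢b (sub a b sa sb)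

module _ {n : ℕ} (G : Graph n) (v : Fin n) where

  Part? : ∀ comp p x → Dec (Part G v comp p x)
  Part? comp p x = Adj? G v x ×-dec (comp x ≟ p)

  shapeFromStars :
    (comp : Fin n → Fin n) →
    (∀ x y → Adj G v x → Adj G v y → Adj G x y → comp x ≡ comp y) →
    (∀ p x → Part G v comp p x → ∃ λ c → IsStarAt G (Part G v comp p) c) →
    (∀ p q → InducesBigStar G (Part G v comp p) →
             InducesBigStar G (Part G v comp q) → p ≡ q) →
    NbhdStarShape G v
  shapeFromStars comp noCrossEdges partsAreStars atMostOneBig =
    comp , noCrossEdges , classify , atMostOneBig
    where
    classify : ∀ p → (∃ λ x → Part G v comp p x) →
               InducesK1 G (Part G v comp p) ⊎ InducesK2 G (Part G v comp p)
                 ⊎ InducesBigStar G (Part G v comp p)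
    classify p (x , px) with partsAreStars p x px
    ... | c , star = starShape G (Part G v comp p) (Part? comp p) c star

module DIMFacts {n : ℕ} {G : Graph n} {M : EdgeSet G} (dim : IsDIM G M) where
  open IsDIM dim

  partnerUnique : ∀ {x y z} → InM M x y → InM M x z → y ≡ z
  partnerUnique {x} {y} {z} xy xz with disjoint x y x z xy xz refl
  ... | inj₁ (_ , y≡z) = y≡z
  ... | inj₂ (x≡z , _) = ⊥-elim (irrefl G (M⊆E M (subst (InM M x) (≡-sym x≡z) xz)))

  -- If vu ∈ M, no M-edge touches a neighbour x ≠ u of v: it would be
  -- joined to vu by the edge vx.
  unmatchedNearMatched : ∀ {v u} → InM M v u →
                         ∀ x w → Adj G v x → x ≢ u → ¬ InM M x w
  unmatchedNearMatched {v} {u} vu x w vx x≢u xw with induced v u x w vu xw vx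
  ... | inj₁ (v≡x , _) = irrefl G (subst (Adj G v) (≡-sym v≡x) vx)
  ... | inj₂ (_ , u≡x) = x≢u (≡-sym u≡x)

  -- Hence, by domination, N(v) ∖ {u} is independent.
  independentNearMatched : ∀ {v u} → InM M v u →
    ∀ x y → Adj G v x → Adj G v y → x ≢ u → y ≢ u → ¬ Adj G x y
  independentNearMatched vu x y vx vy x≢u y≢u xy
    with dominating x y xy (unmatchedNearMatched vu x y vx x≢u)
  ... | w , inj₁ xw = unmatchedNearMatched vu x w vx x≢u xw
  ... | w , inj₂ yw = unmatchedNearMatched vu y w vy y≢u yw

  -- If v is unmatched, each neighbour x is matched, since the edge vx
  -- must be dominated at x.
  neighbourMatched : ∀ {v} → (∀ w → ¬ InM M v w) →
                     ∀ x → Adj G v x → ∃ λ w → InM M x w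
  neighbourMatched {v} unmatched x vx with dominating v x vx (unmatched x)
  ... | w , inj₁ vw = ⊥-elim (unmatched w vw)
  ... | w , inj₂ xw = w , xw

  -- ... and every edge xy inside N(v) is in M: the M-edges at x and y are
  -- joined by xy, so they coincide.
  neighbourEdgeInM : ∀ {v} → (∀ w → ¬ InM M v w) →
    ∀ x y → Adj G v x → Adj G v y → Adj G x y → InM M x y
  neighbourEdgeInM unmatched x y vx vy xy
    with neighbourMatched unmatched x vx | neighbourMatched unmatched y vy
  ... | w , xw | w' , yw' with induced x w y w' xw yw' xy
  ...   | inj₁ (x≡y , _) = ⊥-elim (irrefl G (subst (Adj G x) (≡-sym x≡y) xy))
  ...   | inj₂ (_ , w≡y) = subst (InM M x) w≡y xw

-- Case vu ∈ M: the part of u is N(u) ∩ N(v) together with u, a star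
-- centred at u; every other vertex forms a part of its own.
module MatchedCase {n : ℕ} (G : Graph n) (M : EdgeSet G) (dim : IsDIM G M)
                   (v u : Fin n) (vu : InM M v u) where
  open DIMFacts dim

  comp : Fin n → Fin n
  comp x with Adj? G u x
  ... | yes _ = u
  ... | no _ = x

  comp-spec : ∀ x → (Adj G u x × comp x ≡ u) ⊎ (¬ Adj G u x × comp x ≡ x)
  comp-spec x with Adj? G u x
  ... | yes ux = inj₁ (ux , refl)
  ... | no ¬ux = inj₂ (¬ux , refl)

  comp-u : comp u ≡ u
  comp-u with comp-spec u
  ... | inj₁ (_ , e) = e
  ... | inj₂ (_ , e) = e

  comp-adj : ∀ x → Adj G u x → comp x ≡ u
  comp-adj x ux with comp-spec x
  ... | inj₁ (_ , e) = e
  ... | inj₂ (¬ux , _) = ⊥-elim (¬ux ux)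

  P = Part G v comp

  inPartU : ∀ x → P u x → x ≢ u → Adj G u x
  inPartU x (_ , cx≡u) x≢u with comp-spec x
  ... | inj₁ (ux , _) = ux
  ... | inj₂ (_ , cx≡x) = ⊥-elim (x≢u (trans (≡-sym cx≡x) cx≡u))

  inOtherPart : ∀ p x → p ≢ u → P p x → x ≡ p
  inOtherPart p x p≢u (_ , cx≡p) with comp-spec x
  ... | inj₁ (_ , cx≡u) = ⊥-elim (p≢u (trans (≡-sym cx≡p) cx≡u))
  ... | inj₂ (_ , cx≡x) = trans (≡-sym cx≡x) cx≡p

  noCrossEdges : ∀ x y → Adj G v x → Adj G v y → Adj G x y → comp x ≡ comp y
  noCrossEdges x y vx vy xy with x ≟ u | y ≟ u
  ... | yes refl | _ = trans comp-u (≡-sym (comp-adj y xy))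
  ... | no _ | yes refl = trans (comp-adj x (Graph.sym G xy)) (≡-sym comp-u)
  ... | no x≢u | no y≢u = ⊥-elim (independentNearMatched vu x y vx vy x≢u y≢u xy)

  partsAreStars : ∀ p x → P p x → ∃ λ c → IsStarAt G (P p) c
  partsAreStars p x px with p ≟ u
  ... | yes refl =
    u , (M⊆E M vu , comp-u) , inPartU ,
    (λ y z py pz y≢u z≢u → independentNearMatched vu y z (proj₁ py) (proj₁ pz) y≢u z≢u)
  ... | no p≢u =
    x , singletonStar G (P p) x px
          (λ y py → trans (inOtherPart p y p≢u py) (≡-sym (inOtherPart p x p≢u px)))

  bigStar⇒u : ∀ p → InducesBigStar G (P p) → p ≡ u
  bigStar⇒u p big with p ≟ u
  ... | yes p≡u = p≡u
  ... | no p≢u = ⊥-elim (subsingleton⇒¬bigStar G (P p)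
          (λ x y px py → trans (inOtherPart p x p≢u px) (≡-sym (inOtherPart p y p≢u py))) big)

  shape : NbhdStarShape G v
  shape = shapeFromStars G v comp noCrossEdges partsAreStars
            (λ p q bigP bigQ → trans (bigStar⇒u p bigP) (≡-sym (bigStar⇒u q bigQ)))

-- Case v unmatched: every part is a vertex together with its M-partner
-- (when present), labelled by the smaller of the two.
module UnmatchedCase {n : ℕ} (G : Graph n) (M : EdgeSet G) (dim : IsDIM G M)
                     (v : Fin n) (unmatched : ∀ w → ¬ InM M v w) where
  open DIMFacts dim

  comp : Fin n → Fin n
  comp x with any? (λ y → InM? M x y ×-dec (y <? x))
  ... | yes (y , _) = y
  ... | no _ = x

  comp-spec : ∀ x → (∃ λ y → InM M x y × y < x × comp x ≡ y)
                  ⊎ ((¬ ∃ λ y → InM M x y × y < x) × comp x ≡ x)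
  comp-spec x with any? (λ y → InM? M x y ×-dec (y <? x))
  ... | yes (y , xy , y<x) = inj₁ (y , xy , y<x , refl)
  ... | no noSmaller = inj₂ (noSmaller , refl)

  comp-larger : ∀ x y → InM M x y → y < x → comp x ≡ y
  comp-larger x y xy y<x with comp-spec x
  ... | inj₁ (y' , xy' , _ , cx≡y') = trans cx≡y' (partnerUnique xy' xy)
  ... | inj₂ (noSmaller , _) = ⊥-elim (noSmaller (y , xy , y<x))

  comp-smaller : ∀ x y → InM M x y → x < y → comp x ≡ x
  comp-smaller x y xy x<y with comp-spec x
  ... | inj₁ (y' , xy' , y'<x , _) =
    ⊥-elim (<-asym x<y (subst (_< x) (partnerUnique xy' xy) y'<x))
  ... | inj₂ (_ , cx≡x) = cx≡x

  comp-matched : ∀ x y → InM M x y → comp x ≡ comp y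
  comp-matched x y xy with <-cmp x y
  ... | tri< x<y _ _ = trans (comp-smaller x y xy x<y) (≡-sym (comp-larger y x (M-sym M xy) x<y))
  ... | tri≈ _ refl _ = refl
  ... | tri> _ _ y<x = trans (comp-larger x y xy y<x) (≡-sym (comp-smaller y x (M-sym M xy) y<x))

  P = Part G v comp

  inPart : ∀ p y → P p y → y ≡ p ⊎ InM M y p
  inPart p y (_ , cy≡p) with comp-spec y
  ... | inj₁ (y' , yy' , _ , cy≡y') = inj₂ (subst (InM M y) (trans (≡-sym cy≡y') cy≡p) yy')
  ... | inj₂ (_ , cy≡y) = inj₁ (trans (≡-sym cy≡y) cy≡p)

  equalOrPartners : ∀ p y z → P p y → P p z → y ≡ z ⊎ InM M y z
  equalOrPartners p y z py pz with inPart p y py | inPart p z pz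
  ... | inj₁ refl | inj₁ refl = inj₁ refl
  ... | inj₁ refl | inj₂ zp = inj₂ (M-sym M zp)
  ... | inj₂ yp | inj₁ refl = inj₂ yp
  ... | inj₂ yp | inj₂ zp = inj₁ (partnerUnique (M-sym M yp) (M-sym M zp))

  partsAreStars : ∀ p x → P p x → ∃ λ c → IsStarAt G (P p) c
  partsAreStars p x px = x , px , centre , leavesIndep
    where
    leafIsPartner : ∀ y → P p y → y ≢ x → InM M x y
    leafIsPartner y py y≢x with equalOrPartners p x y px py
    ... | inj₁ x≡y = ⊥-elim (y≢x (≡-sym x≡y))
    ... | inj₂ xy = xy

    centre : ∀ y → P p y → y ≢ x → Adj G x y
    centre y py y≢x = M⊆E M (leafIsPartner y py y≢x)

    -- There is at most one leaf, and it is not adjacent to itself.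
    leavesIndep : ∀ y z → P p y → P p z → y ≢ x → z ≢ x → ¬ Adj G y z
    leavesIndep y z py pz y≢x z≢x yz =
      irrefl G (subst (Adj G y) (≡-sym (partnerUnique (leafIsPartner y py y≢x)
                                                      (leafIsPartner z pz z≢x))) yz)

  -- A big star would have a centre with two distinct M-partners.
  noBigStar : ∀ p → ¬ InducesBigStar G (P p)
  noBigStar p (c , a , b , pc , pa , pb , a≢b , a≢c , b≢c , _)
    with equalOrPartners p c a pc pa | equalOrPartners p c b pc pb
  ... | inj₁ c≡a | _ = a≢c (≡-sym c≡a)
  ... | _ | inj₁ c≡b = b≢c (≡-sym c≡b)
  ... | inj₂ ca | inj₂ cb = a≢b (partnerUnique ca cb)

  shape : NbhdStarShape G v
  shape = shapeFromStars G v comp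
            (λ x y vx vy xy → comp-matched x y (neighbourEdgeInM unmatched x y vx vy xy))
            partsAreStars
            (λ p _ bigP _ → ⊥-elim (noBigStar p bigP))

mainTheorem12 : ∀ {n : ℕ} (G : Graph n) → HasDIM G → (v : Fin n) → NbhdStarShape G v
mainTheorem12 G (M , dim) v with any? (λ w → InM? M v w)
... | yes (u , vu) = MatchedCase.shape G M dim v u vu
... | no noPartner = UnmatchedCase.shape G M dim v (λ w vw → noPartner (w , vw))
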